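{- Let $w\ge 2$, $h=\lfloor w/2\rfloor$, and $2\le\alpha\le 9$. If $m,n\in A_w$ have $p(m)=(\alpha,0,\dots,0)$ and $p(n)=(11-\alpha,0,\dots,0)$, then $K^2(m)=K^2(n)$.
   Context: A $w$-digit number is a string of $w$ decimal digits (leading zeros allowed); $A_w$ is the set of those whose digits are not all identical. For a $w$-digit number $n$, $O_d(n)=x_1\dots x_w$ is obtained by sorting its digits in non-increasing order and $O_u(n)=x_w\dots x_1$ by sorting them in non-decreasing order; the Kaprekar map is $K(n)=O_d(n)-O_u(n)$, written as a $w$-digit string with leading zeros, and $K^2=K\circ K$. The parameters of a $w$-digit number $n$ are $p(n)=(\alpha^1,\dots,\alpha^h)$, $\alpha^i=x_i-x_{w-i+1}$ where $x_1\ge\dots\ge x_w$ are its sorted digits. -}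

module Defs where

open import Data.Nat using (ℕ; zero; suc; _+_; _*_; _∸_; _≤ᵇ_; _/_; _%_)
open import Data.Bool using (if_then_else_)
open import Data.Fin using (Fin; toℕ)
open import Data.Fin.Properties using ()
open import Data.Nat.DivMod using (m%n<n)
open import Data.List using (List; []; _∷_; take; zipWith; replicate)
import Data.List as L
open import Data.Vec using (Vec; []; _∷_; toList; lookup)
import Data.Vec as V
open import Data.Product using (∃₂)
open import Relation.Binary.PropositionalEquality using (_≡_)
open import Relation.Nullary using (¬_)

-- A w-digit number: a string of w decimal digits, most significant first
-- (leading zeros allowed).
Num : ℕ → Set
Num w = Vec (Fin 10) w

digitsℕ : ∀ {w} → Num w → List ℕ
digitsℕ n = toList (V.map toℕ n)

InA : ∀ {w} → Num w → Set
InA {w} n = ∃₂ λ (i j : Fin w) → ¬ (lookup n i ≡ lookup n j)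

insertDesc : ℕ → List ℕ → List ℕ
insertDesc x [] = x ∷ []
insertDesc x (y ∷ ys) = if y ≤ᵇ x then x ∷ y ∷ ys else y ∷ insertDesc x ys

sortDesc : List ℕ → List ℕ
sortDesc [] = []
sortDesc (x ∷ xs) = insertDesc x (sortDesc xs)

value : List ℕ → ℕ
value = L.foldl (λ acc d → 10 * acc + d) 0

Od : ∀ {w} → Num w → ℕ
Od n = value (sortDesc (digitsℕ n))

Ou : ∀ {w} → Num w → ℕ
Ou n = value (L.reverse (sortDesc (digitsℕ n)))

toDigits : (w : ℕ) → ℕ → Num w
toDigits zero    x = []
toDigits (suc k) x = toDigits k (x / 10) V.∷ʳ Data.Fin.fromℕ< (m%n<n x 10)

-- Kaprekar map, written as a w-digit string with leading zeros
K : ∀ {w} → Num w → Num w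
K {w} n = toDigits w (Od n ∸ Ou n)

K² : ∀ {w} → Num w → Num w
K² n = K (K n)

params : ∀ {w} → Num w → List ℕ
params {w} n = zipWith _∸_ (take (w / 2) s) (take (w / 2) (L.reverse s))
  where s = sortDesc (digitsℕ n)

-- Let s = a ∷ mid ∷ʳ b be the digits of m sorted in non-increasing order. The
-- parameter (α,0,…,0) says a ∸ b = α and that mid is constant (it is sorted and
-- its first and last entries agree), so Od m ∸ Ou m = α·(10^(w−1) − 1), whose
-- w-digit string is (α−1) 9…9 (10−α). Replacing α by 11 − α only swaps the
-- two outer digits; since K depends only on the multiset of digits,
-- K (K m) = K (K n).
module Submission where

open import Defs
open import Data.Nat
  using (ℕ; zero; suc; _+_; _*_; _∸_; _^_; _≤_; _≥_; _<_; _≤ᵇ_; _/_; _%_; s≤s; z≤n)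
open import Data.Nat.Properties
open import Data.Nat.DivMod
  using (m%n<n; m/n≤m; m/n≡1+[m∸n]/n; [m+kn]%n≡m%n; m<n⇒m%n≡m; +-distrib-/-∣ʳ; m<n⇒m/n≡0; m*n/n≡m)
open import Data.Nat.Divisibility using (divides-refl)
open import Data.Nat.Tactic.RingSolver using (solve-∀)
open import Data.Bool using (if_then_else_)
open import Data.Fin using (Fin; toℕ; fromℕ<)
open import Data.Fin.Properties using (toℕ-fromℕ<)
open import Data.List
  using (List; []; _∷_; _++_; [_]; _∷ʳ_; length; reverse; replicate; take; zipWith; foldl;
         initLast; _∷ʳ′_)
open import Data.List.Properties
  using (length-++; length-reverse; unfold-reverse; reverse-++; foldl-++; ∷-injective)
open import Data.List.Relation.Unary.All as All using (All; _∷_)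
open import Data.List.Relation.Unary.All.Properties using (∷ʳ⁻; replicate⁺)
open import Data.List.Relation.Unary.Linked as Linked using (Linked; []; [-]; _∷_)
open import Data.List.Relation.Unary.Linked.Properties using (Linked⇒All)
open import Data.List.Relation.Binary.Permutation.Propositional
  using (_↭_; prep; ↭-trans; ↭-sym; ↭⇒↭ₛ)
open import Data.List.Relation.Binary.Permutation.Propositional.Properties using (++-comm; ↭-length)
open import Data.List.Relation.Binary.Pointwise using (Pointwise-≡⇒≡)
open import Data.List.Relation.Unary.Sorted.TotalOrder.Properties using (↗↭↗⇒≋)
import Data.List.Sort.InsertionSort as InsertionSort
import Data.List.Sort.InsertionSort.Properties as InsertionSortProperties
import Data.Vec as V
import Data.Vec.Properties as VP
open import Data.Product using (_,_; proj₂)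
open import Relation.Binary.Bundles using (DecTotalOrder)
open import Relation.Binary.Construct.Flip.EqAndOrd using () renaming (decTotalOrder to flip-decTotalOrder)
open import Relation.Binary.PropositionalEquality hiding ([_])
open ≡-Reasoning

private
  variable
    A : Set

≥-decTotalOrder : DecTotalOrder _ _ _
≥-decTotalOrder = flip-decTotalOrder ≤-decTotalOrder

module ≥-Sort = InsertionSort ≥-decTotalOrder
module ≥-SortProperties = InsertionSortProperties ≥-decTotalOrder

insertDesc≡insert : ∀ x xs → insertDesc x xs ≡ ≥-Sort.insert x xs
insertDesc≡insert x [] = refl
insertDesc≡insert x (y ∷ ys) =
  cong (λ t → if y ≤ᵇ x then x ∷ y ∷ ys else y ∷ t) (insertDesc≡insert x ys)

sortDesc≡sort : ∀ xs → sortDesc xs ≡ ≥-Sort.sort xs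
sortDesc≡sort [] = refl
sortDesc≡sort (x ∷ xs) =
  trans (cong (insertDesc x) (sortDesc≡sort xs)) (insertDesc≡insert x (≥-Sort.sort xs))

sortDesc-↭ : ∀ xs → sortDesc xs ↭ xs
sortDesc-↭ xs = subst (_↭ xs) (sym (sortDesc≡sort xs)) (≥-SortProperties.sort-↭ xs)

sortDesc-↗ : ∀ xs → Linked _≥_ (sortDesc xs)
sortDesc-↗ xs = subst (Linked _≥_) (sym (sortDesc≡sort xs)) (≥-SortProperties.sort-↗ xs)

sortDesc-cong-↭ : ∀ {xs ys} → xs ↭ ys → sortDesc xs ≡ sortDesc ys
sortDesc-cong-↭ {xs} {ys} xs↭ys = Pointwise-≡⇒≡
  (↗↭↗⇒≋ (DecTotalOrder.totalOrder ≥-decTotalOrder) (sortDesc-↗ xs) (sortDesc-↗ ys)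
    (↭⇒↭ₛ (↭-trans (sortDesc-↭ xs) (↭-trans xs↭ys (↭-sym (sortDesc-↭ ys))))))

reverse-∷-∷ʳ : ∀ (a : A) xs b → reverse (a ∷ xs ∷ʳ b) ≡ b ∷ reverse xs ∷ʳ a
reverse-∷-∷ʳ a xs b = begin
  reverse (a ∷ xs ∷ʳ b)   ≡⟨ unfold-reverse a (xs ∷ʳ b) ⟩
  reverse (xs ∷ʳ b) ∷ʳ a  ≡⟨ cong (_∷ʳ a) (reverse-++ xs [ b ]) ⟩
  b ∷ reverse xs ∷ʳ a     ∎

length-∷-∷ʳ : ∀ (a : A) xs b → length (a ∷ xs ∷ʳ b) ≡ 2 + length xs
length-∷-∷ʳ a xs b = cong suc (trans (length-++ xs) (+-comm (length xs) 1))

∷-∷ʳ-↭ : ∀ (a : A) xs b → a ∷ xs ∷ʳ b ↭ b ∷ xs ∷ʳ a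
∷-∷ʳ-↭ a xs b = ↭-trans (++-comm (a ∷ xs) [ b ]) (prep b (++-comm [ a ] xs))

replicate-∷ʳ : ∀ n (x : A) → replicate n x ∷ʳ x ≡ x ∷ replicate n x
replicate-∷ʳ zero    x = refl
replicate-∷ʳ (suc n) x = cong (x ∷_) (replicate-∷ʳ n x)

reverse-replicate : ∀ n (x : A) → reverse (replicate n x) ≡ replicate n x
reverse-replicate zero    x = refl
reverse-replicate (suc n) x = begin
  reverse (x ∷ replicate n x)  ≡⟨ unfold-reverse x (replicate n x) ⟩
  reverse (replicate n x) ∷ʳ x ≡⟨ cong (_∷ʳ x) (reverse-replicate n x) ⟩
  replicate n x ∷ʳ x           ≡⟨ replicate-∷ʳ n x ⟩
  x ∷ replicate n x            ∎

take-++ˡ : ∀ {k} (xs ys : List A) → k ≤ length xs → take k (xs ++ ys) ≡ take k xs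
take-++ˡ {k = zero}  xs       ys k≤ = refl
take-++ˡ {k = suc k} (x ∷ xs) ys (s≤s k≤) = cong (x ∷_) (take-++ˡ xs ys k≤)

Linked-∷ʳ⁻ : ∀ {R : A → A → Set} xs {z} → Linked R (xs ∷ʳ z) → Linked R xs
Linked-∷ʳ⁻ []           _          = []
Linked-∷ʳ⁻ (x ∷ [])     _          = [-]
Linked-∷ʳ⁻ (x ∷ y ∷ xs) (Rxy ∷ ↗) = Rxy ∷ Linked-∷ʳ⁻ (y ∷ xs) ↗

last≤head : ∀ {x z} xs → Linked _≥_ (x ∷ xs ∷ʳ z) → z ≤ x
last≤head xs ↗ = proj₂ (∷ʳ⁻ (All.tail (Linked⇒All (λ y≤x z≤y → ≤-trans z≤y y≤x) ≤-refl ↗)))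

sorted-head≤last⇒constant : ∀ {y z} xs → Linked _≥_ (y ∷ xs ∷ʳ z) → y ≤ z →
  y ∷ xs ∷ʳ z ≡ replicate (2 + length xs) y
sorted-head≤last⇒constant {y} []       (z≤y ∷ [-]) y≤z = cong (λ v → y ∷ [ v ]) (≤-antisym z≤y y≤z)
sorted-head≤last⇒constant {y} {z} (x ∷ xs) (x≤y ∷ ↗) y≤z = cong (y ∷_) (begin
  x ∷ xs ∷ʳ z                 ≡⟨ sorted-head≤last⇒constant xs ↗ (≤-trans x≤y y≤z) ⟩
  replicate (2 + length xs) x ≡⟨ cong (replicate (2 + length xs)) x≡y ⟩
  replicate (2 + length xs) y ∎)
  where
  x≡y : x ≡ y
  x≡y = ≤-antisym x≤y (≤-trans y≤z (last≤head xs ↗))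

sorted-head≤last⇒palindrome : ∀ {y z} xs → Linked _≥_ (y ∷ xs ∷ʳ z) → y ≤ z →
  reverse (y ∷ xs ∷ʳ z) ≡ y ∷ xs ∷ʳ z
sorted-head≤last⇒palindrome {y} {z} xs ↗ y≤z = begin
  reverse (y ∷ xs ∷ʳ z)                 ≡⟨ cong reverse constant ⟩
  reverse (replicate (2 + length xs) y) ≡⟨ reverse-replicate (2 + length xs) y ⟩
  replicate (2 + length xs) y           ≡⟨ sym constant ⟩
  y ∷ xs ∷ʳ z                           ∎
  where
  constant : y ∷ xs ∷ʳ z ≡ replicate (2 + length xs) y
  constant = sorted-head≤last⇒constant xs ↗ y≤z

paramsOf : List ℕ → List ℕ
paramsOf s = zipWith _∸_ (take (length s / 2) s) (take (length s / 2) (reverse s))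

half-∷-∷ʳ : ∀ (a : ℕ) xs b → length (a ∷ xs ∷ʳ b) / 2 ≡ suc (length xs / 2)
half-∷-∷ʳ a xs b = begin
  length (a ∷ xs ∷ʳ b) / 2 ≡⟨ cong (_/ 2) (length-∷-∷ʳ a xs b) ⟩
  (2 + length xs) / 2      ≡⟨ m/n≡1+[m∸n]/n {2 + length xs} {2} (s≤s (s≤s z≤n)) ⟩
  suc (length xs / 2)      ∎

paramsOf-∷-∷ʳ : ∀ a mid b → paramsOf (a ∷ mid ∷ʳ b) ≡ (a ∸ b) ∷ paramsOf mid
paramsOf-∷-∷ʳ a mid b
  rewrite half-∷-∷ʳ a mid b | reverse-∷-∷ʳ a mid b
        | take-++ˡ mid [ b ] (m/n≤m (length mid) 2)
        | take-++ˡ (reverse mid) [ a ]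
            (≤-trans (m/n≤m (length mid) 2) (≤-reflexive (sym (length-reverse mid))))
  = refl

sorted-zero-params⇒palindrome : ∀ mid → Linked _≥_ mid → All (_≡ 0) (paramsOf mid) →
  reverse mid ≡ mid
sorted-zero-params⇒palindrome []      _ _ = refl
sorted-zero-params⇒palindrome (y ∷ t) ↗ zeros with initLast t
... | [] = refl
... | xs ∷ʳ′ z with subst (All (_≡ 0)) (paramsOf-∷-∷ʳ y xs z) zeros
...   | y∸z≡0 ∷ _ = sorted-head≤last⇒palindrome xs ↗ (m∸n≡0⇒m≤n y∸z≡0)

foldl-decimal : ∀ acc xs → foldl (λ acc d → 10 * acc + d) acc xs ≡ acc * 10 ^ length xs + value xs
foldl-decimal acc []       = sym (trans (+-identityʳ _) (*-identityʳ acc))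
foldl-decimal acc (x ∷ xs) = begin
  foldl _ (10 * acc + x) xs
    ≡⟨ foldl-decimal (10 * acc + x) xs ⟩
  (10 * acc + x) * 10 ^ length xs + value xs
    ≡⟨ shift-digit acc x (10 ^ length xs) (value xs) ⟩
  acc * (10 * 10 ^ length xs) + (x * 10 ^ length xs + value xs)
    ≡⟨ cong (acc * (10 * 10 ^ length xs) +_) (sym (foldl-decimal x xs)) ⟩
  acc * (10 * 10 ^ length xs) + value (x ∷ xs) ∎
  where
  shift-digit : ∀ a b c d → (10 * a + b) * c + d ≡ a * (10 * c) + (b * c + d)
  shift-digit = solve-∀

value-∷-∷ʳ : ∀ a xs b → value (a ∷ xs ∷ʳ b) ≡ 10 * (a * 10 ^ length xs + value xs) + b
value-∷-∷ʳ a xs b = begin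
  value (a ∷ xs ∷ʳ b)     ≡⟨ foldl-++ _ 0 (a ∷ xs) [ b ] ⟩
  10 * value (a ∷ xs) + b ≡⟨ cong (λ v → 10 * v + b) (foldl-decimal a xs) ⟩
  10 * (a * 10 ^ length xs + value xs) + b ∎

-- Writing the first digit as d + b, both values share the summand C.
value-∸-value-reverse : ∀ d b mid → reverse mid ≡ mid →
  value ((d + b) ∷ mid ∷ʳ b) ∸ value (reverse ((d + b) ∷ mid ∷ʳ b)) ≡ d * 10 ^ suc (length mid) ∸ d
value-∸-value-reverse d b mid mid-pal = begin
  value ((d + b) ∷ mid ∷ʳ b) ∸ value (reverse ((d + b) ∷ mid ∷ʳ b))
    ≡⟨ cong (value ((d + b) ∷ mid ∷ʳ b) ∸_) reversed ⟩
  value ((d + b) ∷ mid ∷ʳ b) ∸ value (b ∷ mid ∷ʳ (d + b))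
    ≡⟨ cong₂ _∸_ (value-∷-∷ʳ (d + b) mid b) (value-∷-∷ʳ b mid (d + b)) ⟩
  (10 * ((d + b) * P + V) + b) ∸ (10 * (b * P + V) + (d + b))
    ≡⟨ cong₂ _∸_ (split-high d b P V) (split-low d b P V) ⟩
  (C + d * (10 * P)) ∸ (C + d)
    ≡⟨ [m+n]∸[m+o]≡n∸o C (d * (10 * P)) d ⟩
  d * (10 * P) ∸ d ∎
  where
  P V C : ℕ
  P = 10 ^ length mid
  V = value mid
  C = 10 * (b * P + V) + b
  reversed : value (reverse ((d + b) ∷ mid ∷ʳ b)) ≡ value (b ∷ mid ∷ʳ (d + b))
  reversed = cong value (trans (reverse-∷-∷ʳ (d + b) mid b) (cong (λ xs → b ∷ xs ∷ʳ (d + b)) mid-pal))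
  split-high : ∀ d b P V → 10 * ((d + b) * P + V) + b ≡ (10 * (b * P + V) + b) + d * (10 * P)
  split-high = solve-∀
  split-low : ∀ d b P V → 10 * (b * P + V) + (d + b) ≡ (10 * (b * P + V) + b) + d
  split-low = solve-∀

sorted-params⇒value-difference : ∀ j α {k} s → Linked _≥_ s → length s ≡ 2 + j →
  paramsOf s ≡ α ∷ replicate k 0 →
  value s ∸ value (reverse s) ≡ α * 10 ^ suc j ∸ α
sorted-params⇒value-difference j α (a ∷ t) ↗ len ps with initLast t
sorted-params⇒value-difference j α (a ∷ .[]) ↗ () ps | []
... | mid ∷ʳ′ b with ∷-injective (trans (sym (paramsOf-∷-∷ʳ a mid b)) ps)
...   | a∸b≡α , inner-params = begin
  value (a ∷ mid ∷ʳ b) ∸ value (reverse (a ∷ mid ∷ʳ b))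
    ≡⟨ cong (λ x → value (x ∷ mid ∷ʳ b) ∸ value (reverse (x ∷ mid ∷ʳ b))) a≡α+b ⟩
  value ((α + b) ∷ mid ∷ʳ b) ∸ value (reverse ((α + b) ∷ mid ∷ʳ b))
    ≡⟨ value-∸-value-reverse α b mid mid-pal ⟩
  α * 10 ^ suc (length mid) ∸ α
    ≡⟨ cong (λ k → α * 10 ^ suc k ∸ α) |mid|≡j ⟩
  α * 10 ^ suc j ∸ α ∎
  where
  a≡α+b : a ≡ α + b
  a≡α+b = trans (sym (m∸n+n≡m (last≤head mid ↗))) (cong (_+ b) a∸b≡α)
  |mid|≡j : length mid ≡ j
  |mid|≡j = suc-injective (suc-injective (trans (sym (length-∷-∷ʳ a mid b)) len))
  mid-pal : reverse mid ≡ mid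
  mid-pal = sorted-zero-params⇒palindrome mid (Linked-∷ʳ⁻ mid (Linked.tail ↗))
    (subst (All (_≡ 0)) (sym inner-params) (replicate⁺ _ refl))

digits-toDigits-suc : ∀ k x → digitsℕ (toDigits (suc k) x) ≡ digitsℕ (toDigits k (x / 10)) ∷ʳ x % 10
digits-toDigits-suc k x = begin
  V.toList (V.map toℕ (toDigits k (x / 10) V.∷ʳ d))
    ≡⟨ cong V.toList (VP.map-∷ʳ toℕ d (toDigits k (x / 10))) ⟩
  V.toList (V.map toℕ (toDigits k (x / 10)) V.∷ʳ toℕ d)
    ≡⟨ VP.toList-∷ʳ (toℕ d) (V.map toℕ (toDigits k (x / 10))) ⟩
  digitsℕ (toDigits k (x / 10)) ∷ʳ toℕ d
    ≡⟨ cong (digitsℕ (toDigits k (x / 10)) ∷ʳ_) (toℕ-fromℕ< (m%n<n x 10)) ⟩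
  digitsℕ (toDigits k (x / 10)) ∷ʳ x % 10 ∎
  where
  d : Fin 10
  d = fromℕ< (m%n<n x 10)

digits-toDigits-+*10 : ∀ k r q → r < 10 → digitsℕ (toDigits (suc k) (r + q * 10)) ≡ digitsℕ (toDigits k q) ∷ʳ r
digits-toDigits-+*10 k r q r<10 = begin
  digitsℕ (toDigits (suc k) (r + q * 10))
    ≡⟨ digits-toDigits-suc k (r + q * 10) ⟩
  digitsℕ (toDigits k ((r + q * 10) / 10)) ∷ʳ (r + q * 10) % 10
    ≡⟨ cong₂ (λ q′ r′ → digitsℕ (toDigits k q′) ∷ʳ r′) quotient remainder ⟩
  digitsℕ (toDigits k q) ∷ʳ r ∎
  where
  quotient : (r + q * 10) / 10 ≡ q
  quotient = begin
    (r + q * 10) / 10        ≡⟨ +-distrib-/-∣ʳ r (divides-refl q) ⟩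
    r / 10 + q * 10 / 10     ≡⟨ cong₂ _+_ (m<n⇒m/n≡0 r<10) (m*n/n≡m q 10) ⟩
    q                        ∎
  remainder : (r + q * 10) % 10 ≡ r
  remainder = trans ([m+kn]%n≡m%n r q 10) (m<n⇒m%n≡m r<10)

*10∸-split : ∀ c r → 1 ≤ c → r ≤ 10 → c * 10 ∸ r ≡ (10 ∸ r) + (c ∸ 1) * 10
*10∸-split (suc c) r _ r≤10 = +-∸-comm (c * 10) r≤10

*10^suc : ∀ x k → x * 10 ^ suc k ≡ x * 10 ^ k * 10
*10^suc x k = trans (cong (x *_) (*-comm 10 (10 ^ k))) (sym (*-assoc x (10 ^ k) 10))

1≤[1+d]*10^k : ∀ d k → 1 ≤ suc d * 10 ^ k
1≤[1+d]*10^k d k = *-mono-≤ {1} {suc d} {1} {10 ^ k} (s≤s z≤n) (m^n>0 10 k)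

digits-[1+d]*10^k∸1 : ∀ k d → d < 10 →
  digitsℕ (toDigits (suc k) (suc d * 10 ^ k ∸ 1)) ≡ d ∷ replicate k 9
digits-[1+d]*10^k∸1 zero d d<10 = begin
  digitsℕ (toDigits 1 (suc d * 1 ∸ 1)) ≡⟨ cong (λ x → digitsℕ (toDigits 1 x)) d≡ ⟩
  digitsℕ (toDigits 1 (d + 0 * 10))    ≡⟨ digits-toDigits-+*10 0 d 0 d<10 ⟩
  [ d ]                                ∎
  where
  d≡ : suc d * 1 ∸ 1 ≡ d + 0 * 10
  d≡ = trans (cong (_∸ 1) (*-identityʳ (suc d))) (sym (+-identityʳ d))
digits-[1+d]*10^k∸1 (suc k) d d<10 = begin
  digitsℕ (toDigits (suc (suc k)) (suc d * 10 ^ suc k ∸ 1))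
    ≡⟨ cong (λ x → digitsℕ (toDigits (suc (suc k)) x)) (begin
         suc d * 10 ^ suc k ∸ 1  ≡⟨ cong (_∸ 1) (*10^suc (suc d) k) ⟩
         suc d * 10 ^ k * 10 ∸ 1 ≡⟨ *10∸-split _ 1 (1≤[1+d]*10^k d k) (s≤s z≤n) ⟩
         9 + (suc d * 10 ^ k ∸ 1) * 10 ∎) ⟩
  digitsℕ (toDigits (suc (suc k)) (9 + (suc d * 10 ^ k ∸ 1) * 10))
    ≡⟨ digits-toDigits-+*10 (suc k) 9 (suc d * 10 ^ k ∸ 1) ≤-refl ⟩
  digitsℕ (toDigits (suc k) (suc d * 10 ^ k ∸ 1)) ∷ʳ 9
    ≡⟨ cong (_∷ʳ 9) (digits-[1+d]*10^k∸1 k d d<10) ⟩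
  d ∷ replicate k 9 ∷ʳ 9
    ≡⟨ cong (d ∷_) (replicate-∷ʳ k 9) ⟩
  d ∷ replicate (suc k) 9 ∎

kaprekarDigits : ℕ → ℕ → List ℕ
kaprekarDigits j α = (α ∸ 1) ∷ replicate j 9 ∷ʳ (10 ∸ α)

digits-α*10^[1+j]∸α : ∀ j α → 1 ≤ α → α ≤ 10 →
  digitsℕ (toDigits (2 + j) (α * 10 ^ suc j ∸ α)) ≡ kaprekarDigits j α
digits-α*10^[1+j]∸α j α@(suc a) _ α≤10 = begin
  digitsℕ (toDigits (2 + j) (α * 10 ^ suc j ∸ α))
    ≡⟨ cong (λ x → digitsℕ (toDigits (2 + j) x)) (begin
         α * 10 ^ suc j ∸ α  ≡⟨ cong (_∸ α) (*10^suc α j) ⟩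
         α * 10 ^ j * 10 ∸ α ≡⟨ *10∸-split _ α (1≤[1+d]*10^k a j) α≤10 ⟩
         (10 ∸ α) + (α * 10 ^ j ∸ 1) * 10 ∎) ⟩
  digitsℕ (toDigits (2 + j) ((10 ∸ α) + (α * 10 ^ j ∸ 1) * 10))
    ≡⟨ digits-toDigits-+*10 (suc j) (10 ∸ α) (α * 10 ^ j ∸ 1) (s≤s (m∸n≤m 9 a)) ⟩
  digitsℕ (toDigits (suc j) (α * 10 ^ j ∸ 1)) ∷ʳ (10 ∸ α)
    ≡⟨ cong (_∷ʳ (10 ∸ α)) (digits-[1+d]*10^k∸1 j a α≤10) ⟩
  kaprekarDigits j α ∎

kaprekarDigits-complement-↭ : ∀ j α → 1 ≤ α → α ≤ 10 → kaprekarDigits j α ↭ kaprekarDigits j (11 ∸ α)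
kaprekarDigits-complement-↭ j (suc a) _ (s≤s a≤9) =
  subst₂ (λ u v → kaprekarDigits j (suc a) ↭ u ∷ replicate j 9 ∷ʳ v)
    (sym (pred[m∸n]≡m∸[1+n] 10 a)) (sym (m∸[m∸n]≡n (≤-trans a≤9 (n≤1+n 9))))
    (∷-∷ʳ-↭ a (replicate j 9) (9 ∸ a))

K-cong-↭ : ∀ {w} (m n : Num w) → digitsℕ m ↭ digitsℕ n → K m ≡ K n
K-cong-↭ {w} m n m↭n =
  cong (λ s → toDigits w (value s ∸ value (reverse s))) (sortDesc-cong-↭ m↭n)

length-sortDesc-digits : ∀ {w} (m : Num w) → length (sortDesc (digitsℕ m)) ≡ w
length-sortDesc-digits m =
  trans (↭-length (sortDesc-↭ (digitsℕ m))) (VP.length-toList (V.map toℕ m))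

params≡paramsOf : ∀ {w} (m : Num w) → params m ≡ paramsOf (sortDesc (digitsℕ m))
params≡paramsOf m = cong (λ k → zipWith _∸_ (take (k / 2) s) (take (k / 2) (reverse s)))
  (sym (length-sortDesc-digits m))
  where
  s : List ℕ
  s = sortDesc (digitsℕ m)

digits-K : ∀ j α {k} (m : Num (2 + j)) → 1 ≤ α → α ≤ 10 →
  params m ≡ α ∷ replicate k 0 → digitsℕ (K m) ≡ kaprekarDigits j α
digits-K j α m 1≤α α≤10 pm = begin
  digitsℕ (K m)
    ≡⟨ cong (λ x → digitsℕ (toDigits (2 + j) x))
         (sorted-params⇒value-difference j α (sortDesc (digitsℕ m)) (sortDesc-↗ (digitsℕ m))
           (length-sortDesc-digits m) (trans (sym (params≡paramsOf m)) pm)) ⟩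
  digitsℕ (toDigits (2 + j) (α * 10 ^ suc j ∸ α))
    ≡⟨ digits-α*10^[1+j]∸α j α 1≤α α≤10 ⟩
  kaprekarDigits j α ∎

mainTheorem13 : (w : ℕ) → 2 ≤ w → (α : ℕ) → 2 ≤ α → α ≤ 9 →
    (m n : Num w) → InA m → InA n →
    params m ≡ α ∷ replicate (w / 2 ∸ 1) 0 →
    params n ≡ (11 ∸ α) ∷ replicate (w / 2 ∸ 1) 0 →
    K² m ≡ K² n
mainTheorem13 (suc (suc j)) _ α 2≤α α≤9 m n _ _ pm pn = K-cong-↭ (K m) (K n)
  (subst₂ _↭_ (sym (digits-K j α m 1≤α α≤10 pm)) (sym (digits-K j (11 ∸ α) n 1≤11∸α 11∸α≤10 pn))
    (kaprekarDigits-complement-↭ j α 1≤α α≤10))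
  where
  1≤α : 1 ≤ α
  1≤α = ≤-trans (s≤s z≤n) 2≤α
  α≤10 : α ≤ 10
  α≤10 = ≤-trans α≤9 (n≤1+n 9)
  1≤11∸α : 1 ≤ 11 ∸ α
  1≤11∸α = ≤-trans (s≤s z≤n) (∸-monoʳ-≤ 11 α≤9)
  11∸α≤10 : 11 ∸ α ≤ 10
  11∸α≤10 = ∸-monoʳ-≤ 11 1≤α
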